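{- If $\mathit{cfg}=[C_1,\ldots,C_m]$ and $\mathit{cfg}'=[C'_1,\ldots,C'_m]$ are distinct final configurations in $\mathbb{T}^S_{!(T1)}(G)$ with $\mathit{repr}(\mathit{cfg})=\mathit{repr}(\mathit{cfg}')$, then there exist $i,j\in[m]$ with $j\neq i$ such that $C_i=C'_j\neq\emptyset$ and $C'_i=C_j=\emptyset$.
   Context: Let $G=(V,E)$ be a finite undirected graph. A clique is a nonempty set of pairwise adjacent vertices; it is maximal if not properly contained in another clique. Fix an enumeration $\overline{C}_1,\ldots,\overline{C}_m$ of all maximal cliques of $G$. For $v\in V$ let $\mathit{cliques}(v):=\{i\in[m]\mid v\in\overline{C}_i\}$, $d(v):=|\mathit{cliques}(v)|$, and for nonempty $C\subseteq V$ let $\mathit{cliques}(C):=\bigcap_{v\in C}\mathit{cliques}(v)$. Let $\mathit{Rgd}:=\{k\in[m]\mid \exists v\in V,\ \mathit{cliques}(v)=\{k\}\}$. Fix an enumeration $S=[v_1,\ldots,v_s]$ of all vertices $v$ with $d(v)>1$. A configuration is a list $[C_1,\ldots,C_m]$ where each $C_i$ is empty or a clique, $C_i\subseteq\overline{C}_i$, and $\bigcup_i C_i=V$; $\mathit{repr}([C_1,\ldots,C_m]):=\{C_i\mid C_i\neq\emptyset\}$. Write $[C_1,\ldots,C_m]\to_{(v,i)}[C'_1,\ldots,C'_m]$ if $v\in C_i$, $C'_i=C_i$ and $C'_j=C_j\setminus\{v\}$ for $j\neq i$. The search tree $\mathbb{T}^S(G)$ has root $[\overline{C}_1,\ldots,\overline{C}_m]$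 at depth $0$; a node at depth $k<s$ carrying $\mathit{cfg}$ has, for each $i\in\mathit{cliques}(v_{k+1})$, a child at depth $k+1$ carrying $\mathit{cfg}'$ with $\mathit{cfg}\to_{(v_{k+1},i)}\mathit{cfg}'$. For a node reached by $\mathit{cfg}_0\to_{(v_1,i_1)}\cdots\to_{(v_\ell,i_\ell)}\mathit{cfg}$ set $\delta(\mathit{cfg}):=[i_1,\ldots,i_\ell]$. A node $\mathit{cfg}=[C_1,\ldots,C_m]$ with $\delta(\mathit{cfg})=[i_1,\ldots,i_\ell]$ is a $T1$-node if either (a) $\mathit{cliques}(C_a)\cap\mathit{Rgd}\neq\emptyset$ for some $a\in\{i_1,\ldots,i_\ell\}\setminus\mathit{Rgd}$, or (b) $\mathit{cliques}(C_a)\cap\mathit{cliques}(C_b)\neq\emptyset$ for distinct $a,b\in\{i_1,\ldots,i_\ell\}$. $\mathbb{T}^S_{!(T1)}(G)$ is obtained from $\mathbb{T}^S(G)$ by removing every subtree whose root is a $T1$-node; its final configurations are those at depth $s$. -}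

module Defs where

open import Data.Nat using (ℕ; zero; suc; _<_)
open import Data.Fin using (Fin; fromℕ<)
open import Data.Fin.Subset using (Subset; _∈_; _⊆_; _⊂_; ⊥; ⁅_⁆; _-_; ∣_∣; Nonempty)
open import Data.Vec using (Vec; lookup; tabulate)
open import Data.List using (List; []; _∷ʳ_)
open import Data.List.Membership.Propositional using () renaming (_∈_ to _∈ˡ_)
open import Data.Product using (Σ; ∃; ∃-syntax; _×_; _,_)
open import Data.Sum using (_⊎_)
open import Relation.Nullary using (¬_)
open import Relation.Binary.PropositionalEquality using (_≡_; _≢_)

-- A finite undirected graph has vertex set Fin n and adjacency relation E
-- (symmetry is assumed in the statement). Vertex sets are Subset n.

IsClique : ∀ {n} → (Fin n → Fin n → Set) → Subset n → Set
IsClique E C = Nonempty C × (∀ {u v} → u ∈ C → v ∈ C → u ≢ v → E u v)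

IsMaximalClique : ∀ {n} → (Fin n → Fin n → Set) → Subset n → Set
IsMaximalClique E C = IsClique E C × (∀ D → IsClique E D → ¬ (C ⊂ D))

MaxCliqueEnum : ∀ {n m} → (Fin n → Fin n → Set) → Vec (Subset n) m → Set
MaxCliqueEnum {n} {m} E C̄ =
  (∀ i → IsMaximalClique E (lookup C̄ i))
  × (∀ C → IsMaximalClique E C → ∃[ i ] lookup C̄ i ≡ C)
  × (∀ i j → lookup C̄ i ≡ lookup C̄ j → i ≡ j)

module Tree {n m : ℕ} (C̄ : Vec (Subset n) m) where

  cliques : Fin n → Subset m
  cliques v = tabulate (λ i → lookup (lookup C̄ i) v)

  d : Fin n → ℕ
  d v = ∣ cliques v ∣

  InCliquesOf : Subset n → Fin m → Set
  InCliquesOf C k = ∀ {v} → v ∈ C → k ∈ cliques v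

  Rgd : Fin m → Set
  Rgd k = ∃[ v ] cliques v ≡ ⁅ k ⁆

  IsSEnum : ∀ {s} → Vec (Fin n) s → Set
  IsSEnum S =
    (∀ a b → lookup S a ≡ lookup S b → a ≡ b)
    × (∀ v → (1 < d v → ∃[ a ] lookup S a ≡ v) × ((∃[ a ] lookup S a ≡ v) → 1 < d v))

  Config : Set
  Config = Vec (Subset n) m

  Step : Config → Fin n → Fin m → Config → Set
  Step cfg v i cfg' =
    v ∈ lookup cfg i
    × lookup cfg' i ≡ lookup cfg i
    × (∀ j → j ≢ i → lookup cfg' j ≡ lookup cfg j - v)

  T1 : Config → List (Fin m) → Set
  T1 cfg δ =
    (∃[ a ] (a ∈ˡ δ × ¬ Rgd a × ∃[ k ] (InCliquesOf (lookup cfg a) k × Rgd k)))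
    ⊎ (∃[ a ] ∃[ b ] (a ∈ˡ δ × b ∈ˡ δ × a ≢ b
         × ∃[ k ] (InCliquesOf (lookup cfg a) k × InCliquesOf (lookup cfg b) k)))

  module _ {s : ℕ} (S : Vec (Fin n) s) where

    -- PNode k cfg δ : there is a node at depth k of the pruned tree
    -- T^S_{!(T1)}(G) carrying cfg with δ(cfg) = δ (no node on the path
    -- from the root to it, inclusive, is a T1-node).
    data PNode : ℕ → Config → List (Fin m) → Set where
      root  : ¬ T1 C̄ [] → PNode 0 C̄ []
      child : ∀ {k cfg δ i cfg'} → PNode k cfg δ → (h : k < s)
            → i ∈ cliques (lookup S (fromℕ< h))
            → Step cfg (lookup S (fromℕ< h)) i cfg'
            → ¬ T1 cfg' (δ ∷ʳ i)
            → PNode (suc k) cfg' (δ ∷ʳ i)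

    Final : Config → Set
    Final cfg = ∃[ δ ] PNode s cfg δ

  InRepr : Subset n → Config → Set
  InRepr X cfg = X ≢ ⊥ × ∃[ i ] lookup cfg i ≡ X

  SameRepr : Config → Config → Set
  SameRepr cfg cfg' = ∀ X → (InRepr X cfg → InRepr X cfg') × (InRepr X cfg' → InRepr X cfg)

-- At a final node every vertex of S has been assigned, so a nonempty part C_k either
-- was chosen on the path (k ∈ δ) or contains a vertex lying in C̄_k only (k ∈ Rgd),
-- and a rigid index keeps such a private vertex. Consequently no nonempty part C_j
-- lies inside C̄_i for another nonempty part C_i: j ∉ Rgd since C̄_i misses the
-- private vertex of j, so j ∈ δ, and the node is a T1-node by (a) if i ∈ Rgd and
-- by (b) if i ∈ δ. Now take i with C_i ≠ C'_i. As repr(cfg) = repr(cfg'), a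
-- nonempty C_i equals some C'_j ⊆ C̄_j, and this exclusion, applied in cfg and in
-- cfg', forces C'_i = ∅, j ≠ i and C_j = ∅.
module Submission where

open import Defs
open import Data.Nat using (ℕ; suc; _<_; _≤_)
open import Data.Nat.Properties using (m<1+n⇒m<n∨m≡n; m<n⇒m<1+n; n<1+n; ≤⇒≯; ≮⇒≥; <-irrefl)
open import Data.Fin using (Fin; toℕ; fromℕ<)
open import Data.Fin.Properties using (toℕ-injective; toℕ<n; toℕ-fromℕ<; ¬∀⟶∃¬; _≟_)
open import Data.Fin.Subset using (Subset; ⊥; ⁅_⁆; _∈_; _∉_; _⊆_; _─_; ∣_∣; Nonempty; inside)
open import Data.Fin.Subset.Properties
  using (x∈⁅x⁆; x∈⁅y⁆⇒x≡y; x≢y⇒x∉⁅y⁆; ∣⁅x⁆∣≡1; ⊆-antisym; p⊂q⇒∣p∣<∣q∣;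
         p─q⊆p; x∈p∧x∉q⇒x∈p─q; nonempty?; Empty-unique)
open import Data.Vec using (Vec; _∷_; lookup; here; there)
open import Data.Vec.Properties using (lookup∘tabulate; []=⇒lookup; lookup⇒[]=; tabulate∘lookup; tabulate-cong; ≡-dec)
open import Data.Bool.Properties using () renaming (_≟_ to _≟ᵇ_)
open import Data.List.Membership.Propositional using () renaming (_∈_ to _∈ˡ_)
open import Data.List.Relation.Unary.Any using (here)
open import Data.List.Membership.Propositional.Properties using (∈-++⁺ˡ; ∈-++⁺ʳ)
open import Data.Product using (∃-syntax; _×_; _,_; proj₁; proj₂)
open import Data.Sum using (_⊎_; inj₁; inj₂)
open import Function using (_∘_; case_of_)
open import Relation.Nullary using (¬_; yes; no; contradiction)
open import Relation.Binary.PropositionalEquality using (_≡_; _≢_; refl; sym; trans; cong; subst)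

≢⊥⇒Nonempty : ∀ {k} {p : Subset k} → p ≢ ⊥ → Nonempty p
≢⊥⇒Nonempty {p = p} p≢⊥ with nonempty? p
... | yes ne = ne
... | no ¬ne = contradiction (Empty-unique ¬ne) p≢⊥

∣p∣≤1∧x∈p⇒p≡⁅x⁆ : ∀ {k} {x : Fin k} {p} → ∣ p ∣ ≤ 1 → x ∈ p → p ≡ ⁅ x ⁆
∣p∣≤1∧x∈p⇒p≡⁅x⁆ {x = x} {p} ∣p∣≤1 x∈p = ⊆-antisym p⊆⁅x⁆ ⁅x⁆⊆p
  where
  ⁅x⁆⊆p : ⁅ x ⁆ ⊆ p
  ⁅x⁆⊆p y∈⁅x⁆ = subst (_∈ p) (sym (x∈⁅y⁆⇒x≡y _ y∈⁅x⁆)) x∈p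

  p⊆⁅x⁆ : p ⊆ ⁅ x ⁆
  p⊆⁅x⁆ {y} y∈p with y ≟ x
  ... | yes refl = x∈⁅x⁆ x
  ... | no y≢x = contradiction (subst (_< ∣ p ∣) (∣⁅x⁆∣≡1 x) ∣⁅x⁆∣<∣p∣) (≤⇒≯ ∣p∣≤1)
    where
    ∣⁅x⁆∣<∣p∣ : ∣ ⁅ x ⁆ ∣ < ∣ p ∣
    ∣⁅x⁆∣<∣p∣ = p⊂q⇒∣p∣<∣q∣ (⁅x⁆⊆p , y , y∈p , x≢y⇒x∉⁅y⁆ y≢x)

x∈p─q⇒x∉q : ∀ {k} {x : Fin k} {p q} → x ∈ p ─ q → x ∉ q
x∈p─q⇒x∉q {p = _ ∷ _} {inside ∷ _} () here
x∈p─q⇒x∉q {p = _ ∷ _} {_ ∷ _} (there x∈p─q) (there x∈q) = x∈p─q⇒x∉q x∈p─q x∈q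

lookup-ext : ∀ {A : Set} {k} {xs ys : Vec A k} → (∀ i → lookup xs i ≡ lookup ys i) → xs ≡ ys
lookup-ext {xs = xs} {ys} eq = trans (sym (tabulate∘lookup xs)) (trans (tabulate-cong eq) (tabulate∘lookup ys))

module PrunedTree {n m s : ℕ} {C̄ : Vec (Subset n) m} {S : Vec (Fin n) s}
                  (S-enum : Tree.IsSEnum C̄ S) where
  open Tree C̄

  ∈cliques⇒∈C̄ : ∀ {k v} → k ∈ cliques v → v ∈ lookup C̄ k
  ∈cliques⇒∈C̄ {k} {v} k∈ = lookup⇒[]= v (lookup C̄ k)
    (trans (sym (lookup∘tabulate (λ i → lookup (lookup C̄ i) v) k)) ([]=⇒lookup k∈))

  ∈C̄⇒∈cliques : ∀ {k v} → v ∈ lookup C̄ k → k ∈ cliques v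
  ∈C̄⇒∈cliques {k} {v} v∈ = lookup⇒[]= k (cliques v)
    (trans (lookup∘tabulate (λ i → lookup (lookup C̄ i) v) k) ([]=⇒lookup v∈))

  -- u has been assigned to a single clique on the path down to depth t.
  Processed : ℕ → Fin n → Set
  Processed t u = ∃[ a ] (toℕ a < t × lookup S a ≡ u)

  processed-now : ∀ {t} (t<s : t < s) → Processed (suc t) (lookup S (fromℕ< t<s))
  processed-now {t} t<s = fromℕ< t<s , subst (_< suc t) (sym (toℕ-fromℕ< t<s)) (n<1+n t) , refl

  processed-earlier : ∀ {t u} → Processed t u → Processed (suc t) u
  processed-earlier (a , a<t , Sa≡u) = a , m<n⇒m<1+n a<t , Sa≡u

  processed-suc⁻ : ∀ {t u} (t<s : t < s) → Processed (suc t) u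
                 → Processed t u ⊎ lookup S (fromℕ< t<s) ≡ u
  processed-suc⁻ t<s (a , a<1+t , Sa≡u) with m<1+n⇒m<n∨m≡n a<1+t
  ... | inj₁ a<t = inj₁ (a , a<t , Sa≡u)
  ... | inj₂ a≡t = inj₂ (trans (cong (lookup S) (toℕ-injective (trans (toℕ-fromℕ< t<s) (sym a≡t)))) Sa≡u)

  unprocessed⇒d≤1 : ∀ {u} → ¬ Processed s u → d u ≤ 1
  unprocessed⇒d≤1 {u} ¬pu = ≮⇒≥ λ 1<du →
    let a , Sa≡u = proj₁ (proj₂ S-enum u) 1<du in ¬pu (a , toℕ<n a , Sa≡u)

  private-vertex-unprocessed : ∀ {t v k} → cliques v ≡ ⁅ k ⁆ → ¬ Processed t v
  private-vertex-unprocessed {v = v} {k} cliques-v≡⁅k⁆ (a , _ , Sa≡v) =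
    <-irrefl refl (subst (1 <_) (trans (cong ∣_∣ cliques-v≡⁅k⁆) (∣⁅x⁆∣≡1 k))
                                (proj₂ (proj₂ S-enum v) (a , Sa≡v)))

  PNode⇒¬T1 : ∀ {t cfg δ} → PNode S t cfg δ → ¬ T1 cfg δ
  PNode⇒¬T1 (root ¬t1) = ¬t1
  PNode⇒¬T1 (child _ _ _ _ ¬t1) = ¬t1

  part⊆C̄ : ∀ {t cfg δ} → PNode S t cfg δ → ∀ k → lookup cfg k ⊆ lookup C̄ k
  part⊆C̄ (root _) k u∈ = u∈
  part⊆C̄ (child {i = i} node _ _ (_ , cfg'-i , cfg'-j) _) k u∈ with k ≟ i
  ... | yes refl = part⊆C̄ node k (subst (_ ∈_) cfg'-i u∈)
  ... | no k≢i = part⊆C̄ node k (p─q⊆p _ _ (subst (_ ∈_) (cfg'-j k k≢i) u∈))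

  unprocessed-kept : ∀ {t cfg δ} → PNode S t cfg δ
                   → ∀ k {u} → u ∈ lookup C̄ k → ¬ Processed t u → u ∈ lookup cfg k
  unprocessed-kept (root _) k u∈ _ = u∈
  unprocessed-kept (child {i = i} node t<s _ (_ , cfg'-i , cfg'-j) _) k {u} u∈ ¬pu
    with unprocessed-kept node k u∈ (¬pu ∘ processed-earlier) | k ≟ i
  ... | u∈old | yes refl = subst (u ∈_) (sym cfg'-i) u∈old
  ... | u∈old | no k≢i = subst (u ∈_) (sym (cfg'-j k k≢i)) (x∈p∧x∉q⇒x∈p─q u∈old (x≢y⇒x∉⁅y⁆ u≢v))
    where
    u≢v : u ≢ lookup S (fromℕ< t<s)
    u≢v u≡v = ¬pu (subst (Processed _) (sym u≡v) (processed-now t<s))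

  ∈part⇒chosen⊎unprocessed : ∀ {t cfg δ} → PNode S t cfg δ
                           → ∀ k {u} → u ∈ lookup cfg k → k ∈ˡ δ ⊎ ¬ Processed t u
  ∈part⇒chosen⊎unprocessed (root _) k _ = inj₂ λ { (_ , () , _) }
  ∈part⇒chosen⊎unprocessed (child {δ = δ} {i = i} node t<s _ (_ , _ , cfg'-j) _) k {u} u∈ with k ≟ i
  ... | yes refl = inj₁ (∈-++⁺ʳ δ (here refl))
  ... | no k≢i with subst (u ∈_) (cfg'-j k k≢i) u∈
  ...   | u∈old with ∈part⇒chosen⊎unprocessed node k (p─q⊆p _ _ u∈old)
  ...     | inj₁ k∈δ = inj₁ (∈-++⁺ˡ k∈δ)
  ...     | inj₂ ¬pu = inj₂ λ pu → case processed-suc⁻ t<s pu of λ where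
               (inj₁ pu-earlier) → ¬pu pu-earlier
               (inj₂ v≡u) → x∈p─q⇒x∉q u∈old (subst (_∈ ⁅ _ ⁆) v≡u (x∈⁅x⁆ _))

  module _ {cfg δ} (node : PNode S s cfg δ) where

    rigid-part-inhabited : ∀ {k} → Rgd k → ∃[ v ] (v ∈ lookup cfg k × cliques v ≡ ⁅ k ⁆)
    rigid-part-inhabited {k} (v , cliques-v≡⁅k⁆) =
      v , unprocessed-kept node k v∈C̄k (private-vertex-unprocessed cliques-v≡⁅k⁆) , cliques-v≡⁅k⁆
      where
      v∈C̄k : v ∈ lookup C̄ k
      v∈C̄k = ∈cliques⇒∈C̄ (subst (k ∈_) (sym cliques-v≡⁅k⁆) (x∈⁅x⁆ k))

    inhabited-part⇒chosen⊎rigid : ∀ k {u} → u ∈ lookup cfg k → k ∈ˡ δ ⊎ Rgd k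
    inhabited-part⇒chosen⊎rigid k {u} u∈ with ∈part⇒chosen⊎unprocessed node k u∈
    ... | inj₁ k∈δ = inj₁ k∈δ
    ... | inj₂ ¬pu = inj₂ (u , ∣p∣≤1∧x∈p⇒p≡⁅x⁆ (unprocessed⇒d≤1 ¬pu) (∈C̄⇒∈cliques (part⊆C̄ node k u∈)))

    ¬Rgd-if-⊆-other : ∀ {i j} → i ≢ j → lookup cfg j ⊆ lookup C̄ i → ¬ Rgd j
    ¬Rgd-if-⊆-other {i} {j} i≢j Cj⊆C̄i rj with rigid-part-inhabited rj
    ... | v , v∈Cj , cliques-v≡⁅j⁆ = i≢j (x∈⁅y⁆⇒x≡y j (subst (i ∈_) cliques-v≡⁅j⁆ (∈C̄⇒∈cliques (Cj⊆C̄i v∈Cj))))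

  part⊆C̄⇒≡ : ∀ {cfg} → Final S cfg → ∀ i j → lookup cfg i ≢ ⊥ → lookup cfg j ≢ ⊥
            → lookup cfg j ⊆ lookup C̄ i → i ≡ j
  part⊆C̄⇒≡ {cfg} (δ , node) i j Ci≢⊥ Cj≢⊥ Cj⊆C̄i with i ≟ j
  ... | yes i≡j = i≡j
  ... | no i≢j = contradiction t1 (PNode⇒¬T1 node)
    where
    i∈cliques-Cj : InCliquesOf (lookup cfg j) i
    i∈cliques-Cj = ∈C̄⇒∈cliques ∘ Cj⊆C̄i

    ¬rj : ¬ Rgd j
    ¬rj = ¬Rgd-if-⊆-other node i≢j Cj⊆C̄i

    t1 : T1 cfg δ
    t1 with inhabited-part⇒chosen⊎rigid node j (proj₂ (≢⊥⇒Nonempty Cj≢⊥))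
          | inhabited-part⇒chosen⊎rigid node i (proj₂ (≢⊥⇒Nonempty Ci≢⊥))
    ... | inj₂ rj  | _        = contradiction rj ¬rj
    ... | inj₁ j∈δ | inj₂ ri  = inj₁ (j , j∈δ , ¬rj , i , i∈cliques-Cj , ri)
    ... | inj₁ j∈δ | inj₁ i∈δ =
      inj₂ (j , i , j∈δ , i∈δ , i≢j ∘ sym , i , i∈cliques-Cj , ∈C̄⇒∈cliques ∘ part⊆C̄ node i)

  vanished-part-moved : ∀ {A B} → Final S A → Final S B → (∀ X → InRepr X A → InRepr X B)
                      → ∀ i → lookup A i ≢ ⊥ → lookup B i ≡ ⊥
                      → ∃[ j ] (j ≢ i × lookup B j ≡ lookup A i × lookup A j ≡ ⊥)
  vanished-part-moved {A} {B} FA FB reprA⊆reprB i Ai≢⊥ Bi≡⊥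
    with reprA⊆reprB (lookup A i) (Ai≢⊥ , i , refl)
  ... | _ , j , Bj≡Ai = j , j≢i , Bj≡Ai , Aj≡⊥
    where
    j≢i : j ≢ i
    j≢i refl = Ai≢⊥ (trans (sym Bj≡Ai) Bi≡⊥)

    Ai⊆C̄j : lookup A i ⊆ lookup C̄ j
    Ai⊆C̄j = part⊆C̄ (proj₂ FB) j ∘ subst (_ ∈_) (sym Bj≡Ai)

    Aj≡⊥ : lookup A j ≡ ⊥
    Aj≡⊥ with ≡-dec _≟ᵇ_ (lookup A j) ⊥
    ... | yes Aj≡⊥ = Aj≡⊥
    ... | no Aj≢⊥ = contradiction (part⊆C̄⇒≡ FA j i Aj≢⊥ Ai≢⊥ Ai⊆C̄j) j≢i

  inhabited-part-not-moved : ∀ {A B} → Final S A → Final S B → (∀ X → InRepr X A → InRepr X B)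
                           → ∀ i → lookup A i ≢ ⊥ → lookup B i ≢ ⊥ → lookup A i ≡ lookup B i
  inhabited-part-not-moved {A} {B} FA FB reprA⊆reprB i Ai≢⊥ Bi≢⊥
    with reprA⊆reprB (lookup A i) (Ai≢⊥ , i , refl)
  ... | _ , j , Bj≡Ai with part⊆C̄⇒≡ FB i j Bi≢⊥ (Ai≢⊥ ∘ trans (sym Bj≡Ai))
                             (part⊆C̄ (proj₂ FA) i ∘ subst (_ ∈_) Bj≡Ai)
  ...   | refl = sym Bj≡Ai

open PrunedTree

lemma4 : ∀ {n m s} (E : Fin n → Fin n → Set) → (∀ {u v} → E u v → E v u)
       → (C̄ : Vec (Subset n) m) → MaxCliqueEnum E C̄
       → (S : Vec (Fin n) s) → Tree.IsSEnum C̄ S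
       → (cfg cfg' : Vec (Subset n) m)
       → Tree.Final C̄ S cfg → Tree.Final C̄ S cfg'
       → cfg ≢ cfg' → Tree.SameRepr C̄ cfg cfg'
       → ∃[ i ] ∃[ j ] (j ≢ i × lookup cfg i ≡ lookup cfg' j × lookup cfg i ≢ ⊥
                        × lookup cfg' i ≡ ⊥ × lookup cfg j ≡ ⊥)
lemma4 _ _ _ _ _ S-enum A B FA FB A≢B same
  with ¬∀⟶∃¬ _ _ (λ i → ≡-dec _≟ᵇ_ (lookup A i) (lookup B i)) (A≢B ∘ lookup-ext)
... | i , Ai≢Bi with ≡-dec _≟ᵇ_ (lookup A i) ⊥ | ≡-dec _≟ᵇ_ (lookup B i) ⊥
...   | yes Ai≡⊥ | yes Bi≡⊥ = contradiction (trans Ai≡⊥ (sym Bi≡⊥)) Ai≢Bi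
...   | no Ai≢⊥  | no Bi≢⊥  =
  contradiction (inhabited-part-not-moved S-enum FA FB (proj₁ ∘ same) i Ai≢⊥ Bi≢⊥) Ai≢Bi
...   | no Ai≢⊥  | yes Bi≡⊥ =
  let j , j≢i , Bj≡Ai , Aj≡⊥ = vanished-part-moved S-enum FA FB (proj₁ ∘ same) i Ai≢⊥ Bi≡⊥
  in i , j , j≢i , sym Bj≡Ai , Ai≢⊥ , Bi≡⊥ , Aj≡⊥
...   | yes Ai≡⊥ | no Bi≢⊥  =
  let j , j≢i , Aj≡Bi , Bj≡⊥ = vanished-part-moved S-enum FB FA (proj₂ ∘ same) i Bi≢⊥ Ai≡⊥
  in j , i , j≢i ∘ sym , Aj≡Bi , Bi≢⊥ ∘ trans (sym Aj≡Bi) , Bj≡⊥ , Ai≡⊥
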